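{- Let $d,k$ be natural numbers, let $G, H, G', H', \{V_i\}_{i \in [k+1]}, \{W_i\}_{i \in [k+1]}, \{\theta_i\}_{i\in[k]}$ and the random map $\psi:V(H')\to V(G')$ be as described in the context. Suppose that $\theta_i \ge 2|W_i|$ for all $i \in [k]$. For a natural number $s$, let $\phi : V(H') \rightarrow V(G')$ be a map satisfying $\mathbb{P}(\psi = \phi) > 0$ and $\sum_{x \in W_i} \omega(x; \phi)^s \le \frac{1}{2}\theta_i$ for all $i \in [k]$. Then $\phi |_{V(H)}$ is an embedding of $H$ in $G$.
   Context: Notation. For a graph, a vertex set $T$ and an ordered tuple $Q$ of vertices, $N(Q;T)$ is the set of vertices of $T$ adjacent to every vertex of $Q$. For real $\theta>0$: $\omega_\theta(Q;T)=0$ if $|N(Q;T)|\ge\theta$, and $\theta/|N(Q;T)|$ otherwise ($+\infty$ if empty). An embedding is an injective edge-preserving map. Setting. $G$ is a graph with pairwise disjoint vertex subsets $V_1,\dots,V_k$; $H$ is a graph with vertex partition $W_1,\dots,W_k$ into independent sets such that for $i\in[k-1]$ every vertex of $W_i$ has at most $d$ neighbors in $W_{i+1}\cup\cdots\cup W_k$; $\theta_1,\dots,\theta_{k-1}$ are natural numbers. Edges are added to $H$ (between $W_i$ and later parts) so that each $x\in W_i$, $i\in[k-1]$, has exactly $d$ neighbors in $W_{i+1}\cup\cdots\cup W_k$, forming $N^+(x)$. $H'$ is obtained from (this) $H$ by adding a set $W_{k+1}$ of $d$ new vertices, joined to every vertex of $W_k$ and to no other vertex; for $x\in W_k$, $N^+(x)=W_{k+1}$.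 $G'$ is obtained from $G$ by adding a set $V_{k+1}$ of $d$ new vertices adjacent to all other vertices. Set $\theta_k=|V_k|$. For $x\in W_1\cup\dots\cup W_k$, $e_x$ is a fixed ordering of $N^+(x)$ as a $d$-tuple, and $\psi(e_x)$ is the tuple of images. Random process defining $\psi$: (1') map $W_{k+1}$ to $V_{k+1}$ by a uniformly random map (all $d^d$ maps equally likely). Then for $i=k,k-1,\dots,1$: (2) order $W_i$ as $x_1,\dots,x_m$ so that $\omega_{\theta_i}(\psi(e_{x_j});V_i)$ is non-increasing in $j$ (ties broken arbitrarily); (3) for $j=1,\dots,m$, let $e_j=e_{x_j}$, $L_j=N(\psi(e_j);V_i)\setminus\{\psi(x_1),\dots,\psi(x_{j-1})\}$ and set $\psi(x_j)$ by the first applicable rule: (3-1) if $N(\psi(e_j);V_i)=\emptyset$, uniform in $V_i$; (3-2) if $|L_j|<\frac12|N(\psi(e_j);V_i)|$, uniform in $N(\psi(e_j);V_i)$; (3-3) otherwise uniform in $L_j$. For $x\in W_i$, $i\in[k]$, and a map $\phi$: $\omega(x;\phi)=\omega_{\theta_i}(\phi(e_x);V_i)$. -}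

module Defs where

open import Data.Nat as ℕ using (ℕ; zero; suc; _≡ᵇ_; _<ᵇ_; _≤ᵇ_)
open import Data.Bool using (Bool; true; false; _∧_; not; if_then_else_)
open import Data.Fin using (Fin; toℕ; _<_; _≟_) renaming (zero to fz; suc to fs)
open import Data.List using (List; []; _∷_; foldr; allFin)
open import Data.Bool.ListAction using (any)
open import Data.List.Membership.Propositional using (_∈_)
open import Data.List.Relation.Unary.Unique.Propositional using (Unique)
open import Data.List.Relation.Unary.Linked using (Linked)
open import Data.Maybe using (Maybe; just; nothing)
open import Data.Sum using (_⊎_; inj₁; inj₂)
open import Data.Sum.Properties using (≡-dec)
open import Data.Product using (Σ; _×_; _,_; ∃)
open import Data.Unit using (⊤)
open import Data.Empty using (⊥)
open import Data.Integer using (+_)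
open import Data.Rational as ℚ using (ℚ; 0ℚ; 1ℚ)
open import Relation.Nullary using (¬_)
open import Relation.Nullary.Decidable using (⌊_⌋)
open import Relation.Binary.PropositionalEquality using (_≡_; _≢_)
open import Function using (_⇔_)
open import Function.Definitions using (Injective)

count : ∀ {n} → (Fin n → Bool) → ℕ
count {zero}  P = 0
count {suc n} P = (if P fz then 1 else 0) ℕ.+ count {n} (λ i → P (fs i))

allB : ∀ {d} → (Fin d → Bool) → Bool
allB {zero}  P = true
allB {suc d} P = P fz ∧ allB {d} (λ i → P (fs i))

isLast : ∀ {k} → Fin k → Set
isLast {k} i = suc (toℕ i) ≡ k

-- Extended non-negative rationals: nothing = +∞

ℚ∞ : Set
ℚ∞ = Maybe ℚ

_+∞_ : ℚ∞ → ℚ∞ → ℚ∞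
just a +∞ just b = just (a ℚ.+ b)
_      +∞ _      = nothing

_^ℚ_ : ℚ → ℕ → ℚ
q ^ℚ zero  = 1ℚ
q ^ℚ suc s = q ℚ.* (q ^ℚ s)

-- power with exponent s ≥ 1 intended; ∞^s = ∞
_^∞_ : ℚ∞ → ℕ → ℚ∞
just q  ^∞ s = just (q ^ℚ s)
nothing ^∞ s = nothing

_≤∞_ : ℚ∞ → ℚ∞ → Set
just a  ≤∞ just b  = a ℚ.≤ b
just a  ≤∞ nothing = ⊤
nothing ≤∞ just b  = ⊥
nothing ≤∞ nothing = ⊤

-- ω_θ given θ and c = |N(Q;T)|:  0 if c ≥ θ, θ/c otherwise (∞ if c = 0)
ωval : ℕ → ℕ → ℚ∞
ωval θ c = if θ ≤ᵇ c then just 0ℚ else helper c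
  where
  helper : ℕ → ℚ∞
  helper zero    = nothing
  helper (suc c) = just ((+ θ) ℚ./ suc c)

inPart : ∀ {n k} → (Fin n → Maybe (Fin k)) → Fin n → Fin k → Bool
inPart vp v i with vp v
... | just j  = ⌊ j ≟ i ⌋
... | nothing = false

-- V(G) = Fin n, V(G') = Fin n ⊎ Fin d (inj₂ = the new set V_{k+1}).
-- V(H) = Fin h, V(H') = Fin h ⊎ Fin d (inj₂ = the new set W_{k+1}).
-- Parts are indexed by Fin k (index i : Fin k stands for part i+1).

record Setting (d k : ℕ) : Set₁ where
  field
    n      : ℕ
    adjG   : Fin n → Fin n → Bool
    symG   : ∀ u v → adjG u v ≡ adjG v u
    irrG   : ∀ u → adjG u u ≡ false
    -- pairwise disjoint V_1..V_k ⊆ V(G): vp v = just i  iff  v ∈ V_i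
    vp     : Fin n → Maybe (Fin k)
    -- the graph H (already augmented to forward degree exactly d)
    h      : ℕ
    adjH   : Fin h → Fin h → Bool
    symH   : ∀ x y → adjH x y ≡ adjH y x
    irrH   : ∀ x → adjH x x ≡ false
    wp     : Fin h → Fin k
    indep  : ∀ x y → adjH x y ≡ true → wp x ≢ wp y
    -- e_x : fixed ordering of N⁺(x) as a d-tuple of vertices of H'
    e      : Fin h → Fin d → Fin h ⊎ Fin d
    e-inj  : ∀ x → Injective _≡_ _≡_ (e x)
    e-fwd  : ∀ x → ¬ isLast (wp x) →
               (∀ j → ∃ λ y → e x j ≡ inj₁ y) ×
               (∀ y → ((adjH x y ≡ true) × (wp x < wp y)) ⇔ (∃ λ j → e x j ≡ inj₁ y))
    e-last : ∀ x → isLast (wp x) → ∀ j → ∃ λ w → e x j ≡ inj₂ w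
    θ      : Fin k → ℕ
    θ-last : ∀ i → isLast i → θ i ≡ count (λ v → inPart vp v i)

module _ {d k : ℕ} (S : Setting d k) where
  open Setting S

  inV : Fin n → Fin k → Bool
  inV = inPart vp

  V' : Set
  V' = Fin n ⊎ Fin d

  HV' : Set
  HV' = Fin h ⊎ Fin d

  adjG' : V' → V' → Bool
  adjG' (inj₁ u) (inj₁ v) = adjG u v
  adjG' (inj₁ u) (inj₂ b) = true
  adjG' (inj₂ a) (inj₁ v) = true
  adjG' (inj₂ a) (inj₂ b) = not ⌊ a ≟ b ⌋

  sizeW : Fin k → ℕ
  sizeW i = count (λ x → ⌊ wp x ≟ i ⌋)

  Nb : (HV' → V') → Fin h → Fin k → Fin n → Bool
  Nb φ x i v = inV v i ∧ allB (λ j → adjG' (φ (e x j)) (inj₁ v))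

  ω : (HV' → V') → Fin h → ℚ∞
  ω φ x = ωval (θ (wp x)) (count (Nb φ x (wp x)))

  sumω : ℕ → (HV' → V') → Fin k → ℚ∞
  sumω s φ i = foldr (λ x acc → if ⌊ wp x ≟ i ⌋ then (ω φ x ^∞ s) +∞ acc else acc)
                     (just 0ℚ) (allFin h)

  usedB : (HV' → V') → List (Fin h) → Fin n → Bool
  usedB φ prev v = any (λ y → ⌊ ≡-dec _≟_ _≟_ (φ (inj₁ y)) (inj₁ v) ⌋) prev

  -- φ(x) lies in the support of the rule (3-1)/(3-2)/(3-3), given earlier vertices prev
  StepOK : (HV' → V') → Fin k → List (Fin h) → Fin h → Set
  StepOK φ i prev x =
    if count N ≡ᵇ 0
      then (∃ λ v → (inV v i ≡ true) × (φ (inj₁ x) ≡ inj₁ v))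
      else (if 2 ℕ.* count L <ᵇ count N
              then (∃ λ v → (N v ≡ true) × (φ (inj₁ x) ≡ inj₁ v))
              else (∃ λ v → (L v ≡ true) × (φ (inj₁ x) ≡ inj₁ v)))
    where
    N : Fin n → Bool
    N = Nb φ x i
    L : Fin n → Bool
    L v = N v ∧ not (usedB φ prev v)

  ValidSeq : (HV' → V') → Fin k → List (Fin h) → List (Fin h) → Set
  ValidSeq φ i prev []       = ⊤
  ValidSeq φ i prev (x ∷ xs) = StepOK φ i prev x × ValidSeq φ i (x ∷ prev) xs

  -- φ is a possible outcome of the process, i.e. ℙ(ψ = φ) > 0
  Possible : (HV' → V') → Set
  Possible φ =
    (∀ w → ∃ λ b → φ (inj₂ w) ≡ inj₂ b) ×
    -- for every part i an ordering of W_i as in (2) along which (3) is followed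
    (∀ i → Σ (List (Fin h)) λ ord →
        Unique ord ×
        (∀ x → (x ∈ ord) ⇔ (wp x ≡ i)) ×
        Linked (λ x y → ω φ y ≤∞ ω φ x) ord ×
        ValidSeq φ i [] ord)

  IsEmbedding : (HV' → V') → Set
  IsEmbedding φ = Σ (Fin h → Fin n) λ f →
    (∀ x → φ (inj₁ x) ≡ inj₁ (f x)) ×
    Injective _≡_ _≡_ f ×
    (∀ x y → adjH x y ≡ true → adjG (f x) (f y) ≡ true)

  V'H : Set
  V'H = HV' → V'

-- Fix a part W_i and the ordering x_1, …, x_m used by the process. When x_j is placed,
-- ω(x_j) ≤ ω(x_l) for every l < j, so if ω(x_j) = θ_i/c ≥ 1 (c the number of candidates)
-- then j·θ_i/c ≤ Σ_{x ∈ W_i} ω(x)^s ≤ θ_i/2, i.e. c ≥ 2j; if ω(x_j) = 0 then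
-- c ≥ θ_i ≥ 2|W_i| ≥ 2j; and ω(x_j) = ∞ is excluded by the weight bound. At most j − 1
-- candidates are already used, so at least half of them are free: rule (3-3) applies and
-- x_j lands on a free common neighbour of the images of its forward neighbours. Hence the
-- images within W_i are distinct, images of different parts lie in disjoint sets V_i, and
-- every edge of H is mapped onto an edge of G.
module Submission where

open import Defs
open import Data.Bool using (Bool; true; false; _∧_; _∨_; not; if_then_else_; T)
open import Data.Bool.ListAction using (any)
open import Data.Empty using (⊥-elim)
open import Data.Fin as Fin using (Fin; toℕ; _≟_) renaming (zero to fz; suc to fs)
import Data.Fin.Properties as FinP
open import Data.Integer as ℤ using (+_)
import Data.Integer.Properties as ℤP
open import Data.Integer.Solver using (module +-*-Solver)
open import Data.List using (List; []; _∷_; _++_; length; reverse; reverseAcc; foldr; tabulate; allFin)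
open import Data.List.Membership.Propositional using (_∈_)
open import Data.List.Membership.Propositional.Properties using (∈-∃++; ∈-++⁻; ∈-++⁺ˡ; ∈-++⁺ʳ; ∈-allFin)
open import Data.List.Properties using (length-reverse; length-++-sucʳ; length-++-≤ˡ; ++-assoc)
open import Data.List.Relation.Binary.Subset.Propositional using (_⊆_)
open import Data.List.Relation.Unary.All as All using (All; []; _∷_)
import Data.List.Relation.Unary.All.Properties as All
open import Data.List.Relation.Unary.AllPairs using (AllPairs; []; _∷_)
open import Data.List.Relation.Unary.Any using (here; there)
import Data.List.Relation.Unary.Any as Any
import Data.List.Relation.Unary.Any.Properties as Any
open import Data.List.Relation.Unary.Linked using (Linked)
open import Data.List.Relation.Unary.Linked.Properties using (Linked⇒AllPairs)
open import Data.List.Relation.Unary.Unique.Propositional using (Unique)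
open import Data.Maybe using (Maybe; just; nothing)
open import Data.Nat as ℕ using (ℕ; zero; suc; z≤n; s≤s; _≤_; _<_; _*_; _+_; _≡ᵇ_; _<ᵇ_; _≤ᵇ_)
import Data.Nat.Properties as ℕP
open import Algebra.Properties.CommutativeSemigroup ℕP.+-commutativeSemigroup using (interchange)
open import Data.Product using (Σ; ∃; ∃₂; _×_; _,_; proj₁; proj₂)
open import Data.Rational as ℚ using (ℚ; 0ℚ; 1ℚ; _/_; toℚᵘ)
import Data.Rational.Properties as ℚP
open import Data.Rational.Unnormalised as ℚᵘ using (mkℚᵘ; *≤*)
import Data.Rational.Unnormalised.Properties as ℚᵘP
open import Data.Sum using (_⊎_; inj₁; inj₂)
open import Data.Sum.Properties using (≡-dec; inj₁-injective)
open import Data.Unit using (tt)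
open import Function using (_∘_; _⇔_; Equivalence)
open import Relation.Binary using (tri<; tri≈; tri>)
open import Relation.Binary.PropositionalEquality
open import Relation.Nullary using (¬_; yes; no)
open import Relation.Nullary.Decidable using (⌊_⌋; fromWitness)

if-else : ∀ {A B : Set} {b} → b ≡ false → (if b then A else B) → B
if-else refl x = x

∧-true⁻ : ∀ {a b} → a ∧ b ≡ true → a ≡ true × b ≡ true
∧-true⁻ {true} b≡true = refl , b≡true

∧-not-true⁻ : ∀ {a b} → a ∧ not b ≡ true → a ≡ true × b ≡ false
∧-not-true⁻ {true} {false} _ = refl , refl

∧-not-split : ∀ {a b} → a ≡ true → a ∧ not b ≡ true ⊎ b ≡ true
∧-not-split {true} {false} _ = inj₁ refl
∧-not-split {true} {true}  _ = inj₂ refl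

allB-true⁻ : ∀ {d} {P : Fin d → Bool} → allB P ≡ true → ∀ j → P j ≡ true
allB-true⁻ {suc d} all fz     = proj₁ (∧-true⁻ all)
allB-true⁻ {suc d} all (fs j) = allB-true⁻ (proj₂ (∧-true⁻ all)) j

≡-true : ∀ {A : Set} {x y : A} {dec} → x ≡ y → ⌊ dec ⌋ ≡ true
≡-true {dec = yes _} _  = refl
≡-true {dec = no ¬p} eq = ⊥-elim (¬p eq)

true-≡ : ∀ {A : Set} {x y : A} {dec} → ⌊ dec ⌋ ≡ true → x ≡ y
true-≡ {dec = yes eq} _ = eq

≢0⇒≡ᵇ0-false : ∀ {c} → 0 < c → (c ≡ᵇ 0) ≡ false
≢0⇒≡ᵇ0-false (s≤s _) = refl

≤⇒<ᵇ-false : ∀ {m n} → n ≤ m → (m <ᵇ n) ≡ false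
≤⇒<ᵇ-false {m} {n} n≤m with m <ᵇ n in eq
... | false = refl
... | true  = ⊥-elim (ℕP.≤⇒≯ n≤m (ℕP.<ᵇ⇒< m n (subst T (sym eq) tt)))

≤ᵇ-true⁻ : ∀ {m n} → (m ≤ᵇ n) ≡ true → m ≤ n
≤ᵇ-true⁻ {m} {n} eq = ℕP.≤ᵇ⇒≤ m n (subst T (sym eq) tt)

≤ᵇ-false⁻ : ∀ {m n} → (m ≤ᵇ n) ≡ false → n < m
≤ᵇ-false⁻ eq = ℕP.≰⇒> (λ m≤n → subst T eq (ℕP.≤⇒≤ᵇ m≤n))

∈-order : ∀ {A : Set} {x y : A} {xs} → x ∈ xs → y ∈ xs → x ≢ y →
          (∃₂ λ pre post → xs ≡ pre ++ y ∷ post × x ∈ pre) ⊎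
          (∃₂ λ pre post → xs ≡ pre ++ x ∷ post × y ∈ pre)
∈-order x∈xs y∈xs x≢y with ∈-∃++ y∈xs
... | pre , post , refl with ∈-++⁻ pre x∈xs
...   | inj₁ x∈pre         = inj₁ (pre , post , refl , x∈pre)
...   | inj₂ (here x≡y)    = ⊥-elim (x≢y x≡y)
...   | inj₂ (there x∈post) with ∈-∃++ x∈post
...     | mid , post′ , refl =
  inj₂ (pre ++ _ ∷ mid , post′ , sym (++-assoc pre (_ ∷ mid) (_ ∷ post′)) , ∈-++⁺ʳ pre (here refl))

AllPairs-before : ∀ {A : Set} {R : A → A → Set} xs {y ys} →
                  AllPairs R (xs ++ y ∷ ys) → All (λ x → R x y) xs
AllPairs-before []       _          = []
AllPairs-before (x ∷ xs) (Rx ∷ Rxs) = All.head (All.++⁻ʳ xs Rx) ∷ AllPairs-before xs Rxs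

module OrderedSum {C : Set} (_⊕_ : C → C → C) (ε : C) (_⊑_ : C → C → Set)
  (⊑-refl : ∀ {a} → a ⊑ a)
  (⊕-mono : ∀ {a b c d} → a ⊑ b → c ⊑ d → (a ⊕ c) ⊑ (b ⊕ d))
  (⊕-assoc : ∀ a b c → (a ⊕ b) ⊕ c ≡ a ⊕ (b ⊕ c))
  (⊕-comm : ∀ a b → a ⊕ b ≡ b ⊕ a)
  (⊕-identityˡ : ∀ a → ε ⊕ a ≡ a) where

  module _ {A : Set} where

    sum : (A → C) → List A → C
    sum g []       = ε
    sum g (x ∷ xs) = g x ⊕ sum g xs

    sum-if : ∀ (b : A → Bool) (f : A → C) xs →
             foldr (λ x acc → if b x then f x ⊕ acc else acc) ε xs ≡ sum (λ x → if b x then f x else ε) xs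
    sum-if b f []       = refl
    sum-if b f (x ∷ xs) with b x
    ... | true  = cong (f x ⊕_) (sum-if b f xs)
    ... | false = trans (sum-if b f xs) (sym (⊕-identityˡ _))

    module _ {g : A → C} (nonneg : ∀ x → ε ⊑ g x) where

      sum-nonneg : ∀ xs → ε ⊑ sum g xs
      sum-nonneg []       = ⊑-refl
      sum-nonneg (x ∷ xs) = subst (_⊑ sum g (x ∷ xs)) (⊕-identityˡ ε) (⊕-mono (nonneg x) (sum-nonneg xs))

      sum-++-≥ˡ : ∀ xs ys → sum g xs ⊑ sum g (xs ++ ys)
      sum-++-≥ˡ []       ys = sum-nonneg ys
      sum-++-≥ˡ (x ∷ xs) ys = ⊕-mono ⊑-refl (sum-++-≥ˡ xs ys)

      sum-pull : ∀ xs y ys → sum g (xs ++ y ∷ ys) ≡ g y ⊕ sum g (xs ++ ys)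
      sum-pull []       y ys = refl
      sum-pull (x ∷ xs) y ys = begin
        g x ⊕ sum g (xs ++ y ∷ ys)     ≡⟨ cong (g x ⊕_) (sum-pull xs y ys) ⟩
        g x ⊕ (g y ⊕ sum g (xs ++ ys)) ≡⟨ sym (⊕-assoc _ _ _) ⟩
        (g x ⊕ g y) ⊕ sum g (xs ++ ys) ≡⟨ cong (_⊕ sum g (xs ++ ys)) (⊕-comm _ _) ⟩
        (g y ⊕ g x) ⊕ sum g (xs ++ ys) ≡⟨ ⊕-assoc _ _ _ ⟩
        g y ⊕ sum g (x ∷ xs ++ ys)     ∎
        where open ≡-Reasoning

      sum-before : ∀ xs y ys → sum g (y ∷ xs) ⊑ sum g (xs ++ y ∷ ys)
      sum-before xs y ys = subst (sum g (y ∷ xs) ⊑_) (sym (sum-pull xs y ys)) (⊕-mono ⊑-refl (sum-++-≥ˡ xs ys))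

      sum-mono-⊆ : ∀ {xs ys} → Unique xs → xs ⊆ ys → sum g xs ⊑ sum g ys
      sum-mono-⊆ {[]}     {ys} _ _ = sum-nonneg ys
      sum-mono-⊆ {x ∷ xs} (x∉xs ∷ uniq) xs⊆ys with ∈-∃++ (xs⊆ys (here refl))
      ... | pre , post , refl =
        subst ((g x ⊕ sum g xs) ⊑_) (sym (sum-pull pre x post)) (⊕-mono ⊑-refl (sum-mono-⊆ uniq xs⊆pre++post))
        where
        xs⊆pre++post : xs ⊆ pre ++ post
        xs⊆pre++post {z} z∈xs with ∈-++⁻ pre (xs⊆ys (there z∈xs))
        ... | inj₁ z∈pre          = ∈-++⁺ˡ z∈pre
        ... | inj₂ (here z≡x)     = ⊥-elim (All.lookup x∉xs z∈xs (sym z≡x))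
        ... | inj₂ (there z∈post) = ∈-++⁺ʳ pre z∈post

module ℕSum = OrderedSum _+_ 0 _≤_ ℕP.≤-refl ℕP.+-mono-≤ ℕP.+-assoc ℕP.+-comm ℕP.+-identityˡ

indicator : Bool → ℕ
indicator b = if b then 1 else 0

count-tabulate : ∀ {n} {A : Set} (f : Fin n → A) (P : A → Bool) →
                 count (P ∘ f) ≡ ℕSum.sum (indicator ∘ P) (tabulate f)
count-tabulate {zero}  f P = refl
count-tabulate {suc n} f P = cong (indicator (P (f fz)) ℕ.+_) (count-tabulate (f ∘ fs) P)

length≤count : ∀ {n} {P : Fin n → Bool} {xs} → Unique xs → All (λ x → P x ≡ true) xs → length xs ≤ count P
length≤count {n} {P} {xs} uniq Pxs = begin
  length xs                             ≡⟨ sym (sum-indicator Pxs) ⟩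
  ℕSum.sum (indicator ∘ P) xs           ≤⟨ ℕSum.sum-mono-⊆ (λ _ → z≤n) uniq (λ {x} _ → ∈-allFin x) ⟩
  ℕSum.sum (indicator ∘ P) (allFin n)   ≡⟨ sym (count-tabulate (λ x → x) P) ⟩
  count P                               ∎
  where
  open ℕP.≤-Reasoning
  sum-indicator : ∀ {ys} → All (λ x → P x ≡ true) ys → ℕSum.sum (indicator ∘ P) ys ≡ length ys
  sum-indicator []         = refl
  sum-indicator (Px ∷ Pys) = cong₂ _+_ (cong indicator Px) (sum-indicator Pys)

count-≤-+ : ∀ {n} (P Q R : Fin n → Bool) → (∀ v → P v ≡ true → Q v ≡ true ⊎ R v ≡ true) →
            count P ≤ count Q + count R
count-≤-+ {zero}  P Q R P⊆Q∪R = z≤n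
count-≤-+ {suc n} P Q R P⊆Q∪R = begin
  indicator (P fz) + count (P ∘ fs)
    ≤⟨ ℕP.+-mono-≤ (indicator-≤-+ (P fz) (Q fz) (R fz) (P⊆Q∪R fz)) (count-≤-+ (P ∘ fs) (Q ∘ fs) (R ∘ fs) (P⊆Q∪R ∘ fs)) ⟩
  (indicator (Q fz) + indicator (R fz)) + (count (Q ∘ fs) + count (R ∘ fs))
    ≡⟨ interchange (indicator (Q fz)) (indicator (R fz)) (count (Q ∘ fs)) (count (R ∘ fs)) ⟩
  count Q + count R ∎
  where
  open ℕP.≤-Reasoning
  indicator-≤-+ : ∀ p q r → (p ≡ true → q ≡ true ⊎ r ≡ true) → indicator p ≤ indicator q + indicator r
  indicator-≤-+ false q     r     _ = z≤n
  indicator-≤-+ true  true  r     _ = s≤s z≤n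
  indicator-≤-+ true  false true  _ = s≤s z≤n
  indicator-≤-+ true  false false h with h refl
  ... | inj₁ ()
  ... | inj₂ ()

count-false : ∀ {n} (P : Fin n → Bool) → (∀ v → P v ≡ false) → count P ≡ 0
count-false {zero}  P ¬P = refl
count-false {suc n} P ¬P rewrite ¬P fz = count-false (P ∘ fs) (¬P ∘ fs)

count-≤1 : ∀ {n} (P : Fin n → Bool) → (∀ u v → P u ≡ true → P v ≡ true → u ≡ v) → count P ≤ 1
count-≤1 {zero}  P P-unique = z≤n
count-≤1 {suc n} P P-unique with P fz in P0
... | true  = ℕP.≤-reflexive (cong suc (count-false (P ∘ fs) rest-false))
  where
  rest-false : ∀ v → P (fs v) ≡ false
  rest-false v with P (fs v) in Pv
  ... | false = refl
  ... | true  with () ← P-unique fz (fs v) P0 Pv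
... | false = count-≤1 (P ∘ fs) (λ u v Pu Pv → FinP.suc-injective (P-unique (fs u) (fs v) Pu Pv))

count-any≤length : ∀ {n} {A : Set} (p : A → Fin n → Bool) → (∀ a u v → p a u ≡ true → p a v ≡ true → u ≡ v) →
                   (xs : List A) → count (λ v → any (λ x → p x v) xs) ≤ length xs
count-any≤length {n} p p-unique [] = ℕP.≤-reflexive (count-false {n} _ (λ _ → refl))
count-any≤length p p-unique (x ∷ xs) = ℕP.≤-trans
  (count-≤-+ _ (p x) (λ v → any (λ x → p x v) xs) split)
  (ℕP.+-mono-≤ (count-≤1 (p x) (p-unique x)) (count-any≤length p p-unique xs))
  where
  split : ∀ v → (p x v ∨ any (λ x → p x v) xs) ≡ true → p x v ≡ true ⊎ any (λ x → p x v) xs ≡ true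
  split v h with p x v
  ... | true  = inj₁ refl
  ... | false = inj₂ h

half-free : ∀ c l p → c ≤ l + p → 2 * suc p ≤ c → c ≤ 2 * l
half-free c l p c≤l+p room = ℕP.+-cancelʳ-≤ c c (2 * l) (begin
  c + c               ≤⟨ ℕP.+-mono-≤ c≤l+p c≤l+p ⟩
  (l + p) + (l + p)   ≡⟨ interchange l p l p ⟩
  (l + l) + (p + p)   ≡⟨ cong₂ _+_ (cong (l ℕ.+_) (sym (ℕP.+-identityʳ l))) (cong (p ℕ.+_) (sym (ℕP.+-identityʳ p))) ⟩
  2 * l + 2 * p       ≤⟨ ℕP.+-monoʳ-≤ (2 * l) (ℕP.≤-trans (ℕP.*-monoʳ-≤ 2 (ℕP.n≤1+n p)) room) ⟩
  2 * l + c           ∎)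
  where open ℕP.≤-Reasoning

fromℕ : ℕ → ℚ
fromℕ m = + m / 1

toℚᵘ-/ : ∀ a c → toℚᵘ (+ a / suc c) ℚᵘ.≃ mkℚᵘ (+ a) c
toℚᵘ-/ a c = ℚP.toℚᵘ-fromℚᵘ (mkℚᵘ (+ a) c)

fromℕ-suc : ∀ j → fromℕ (suc j) ≡ 1ℚ ℚ.+ fromℕ j
fromℕ-suc j = ℚP.toℚᵘ-injective (ℚᵘP.≃-sym (begin
  toℚᵘ (1ℚ ℚ.+ fromℕ j)              ≈⟨ ℚP.toℚᵘ-homo-+ 1ℚ (fromℕ j) ⟩
  mkℚᵘ (+ 1) 0 ℚᵘ.+ toℚᵘ (fromℕ j)   ≈⟨ ℚᵘP.+-congʳ (mkℚᵘ (+ 1) 0) (toℚᵘ-/ j 0) ⟩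
  mkℚᵘ (+ 1) 0 ℚᵘ.+ mkℚᵘ (+ j) 0     ≈⟨ ℚᵘ.*≡* (solve 1 (λ j → (con (+ 1) :* con (+ 1) :+ j :* con (+ 1)) :* con (+ 1)
                                                            := (con (+ 1) :+ j) :* con (+ 1)) refl (+ j)) ⟩
  mkℚᵘ (+ suc j) 0                   ≈⟨ ℚᵘP.≃-sym (toℚᵘ-/ (suc j) 0) ⟩
  toℚᵘ (fromℕ (suc j))               ∎))
  where
  open ℚᵘP.≃-Reasoning
  open +-*-Solver

*-fromℕ-suc : ∀ q j → q ℚ.* fromℕ (suc j) ≡ q ℚ.+ q ℚ.* fromℕ j
*-fromℕ-suc q j = begin
  q ℚ.* fromℕ (suc j)       ≡⟨ cong (q ℚ.*_) (fromℕ-suc j) ⟩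
  q ℚ.* (1ℚ ℚ.+ fromℕ j)    ≡⟨ ℚP.*-distribˡ-+ q 1ℚ (fromℕ j) ⟩
  q ℚ.* 1ℚ ℚ.+ q ℚ.* fromℕ j ≡⟨ cong (ℚ._+ q ℚ.* fromℕ j) (ℚP.*-identityʳ q) ⟩
  q ℚ.+ q ℚ.* fromℕ j       ∎
  where open ≡-Reasoning

1≤θ/c : ∀ θ c → suc c ≤ θ → 1ℚ ℚ.≤ + θ / suc c
1≤θ/c θ c c<θ = ℚP.toℚᵘ-cancel-≤ (ℚᵘP.≤-respʳ-≃ (ℚᵘP.≃-sym (toℚᵘ-/ θ c))
  (*≤* (subst₂ ℤ._≤_ (sym (ℤP.*-identityˡ (+ suc c))) (sym (ℤP.*-identityʳ (+ θ))) (ℤ.+≤+ c<θ))))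

θ/c*m≤θ/2⇒2m≤c : ∀ θ c m → .{{ℕ.NonZero θ}} → (+ θ / suc c) ℚ.* fromℕ m ℚ.≤ + θ / 2 → 2 * m ≤ suc c
θ/c*m≤θ/2⇒2m≤c θ c m bound = ℕP.*-cancelˡ-≤ θ (subst₂ _≤_ θ[m2] θ[c1] (ℤP.drop‿+≤+ integral))
  where
  unnormalised : mkℚᵘ (+ θ) c ℚᵘ.* mkℚᵘ (+ m) 0 ℚᵘ.≤ mkℚᵘ (+ θ) 1
  unnormalised = ℚᵘP.≤-respˡ-≃ (ℚᵘP.≃-trans (ℚP.toℚᵘ-homo-* (+ θ / suc c) (fromℕ m)) (ℚᵘP.*-cong (toℚᵘ-/ θ c) (toℚᵘ-/ m 0)))
                   (ℚᵘP.≤-respʳ-≃ (toℚᵘ-/ θ 1) (ℚP.toℚᵘ-mono-≤ bound))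
  integral : + (θ * m * 2) ℤ.≤ + (θ * (suc c * 1))
  integral = subst₂ ℤ._≤_ (trans (cong (ℤ._* + 2) (sym (ℤP.pos-* θ m))) (sym (ℤP.pos-* (θ * m) 2)))
                          (sym (ℤP.pos-* θ (suc c * 1))) (ℚᵘP.drop-*≤* unnormalised)
  θ[m2] : θ * m * 2 ≡ θ * (2 * m)
  θ[m2] = trans (ℕP.*-assoc θ m 2) (cong (θ *_) (ℕP.*-comm m 2))
  θ[c1] : θ * (suc c * 1) ≡ θ * suc c
  θ[c1] = cong (θ *_) (ℕP.*-identityʳ (suc c))

^ℚ-nonneg : ∀ {a} s → 0ℚ ℚ.≤ a → 0ℚ ℚ.≤ a ^ℚ s
^ℚ-nonneg     zero    0≤a = ℚP.nonNegative⁻¹ 1ℚ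
^ℚ-nonneg {a} (suc s) 0≤a = ℚP.nonNegative⁻¹ _
  {{ℚP.nonNeg*nonNeg⇒nonNeg a {{ℚ.nonNegative 0≤a}} (a ^ℚ s) {{ℚ.nonNegative (^ℚ-nonneg s 0≤a)}}}}

1≤^ℚ : ∀ {a} s → 1ℚ ℚ.≤ a → 1ℚ ℚ.≤ a ^ℚ s
≤^ℚ : ∀ {a} s → 1 ≤ s → 1ℚ ℚ.≤ a → a ℚ.≤ a ^ℚ s

1≤^ℚ zero    1≤a = ℚP.≤-refl
1≤^ℚ (suc s) 1≤a = ℚP.≤-trans 1≤a (≤^ℚ (suc s) (s≤s z≤n) 1≤a)

≤^ℚ {a} (suc s) _ 1≤a = ℚP.≤-trans (ℚP.≤-reflexive (sym (ℚP.*-identityʳ a)))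
  (ℚP.*-monoˡ-≤-nonNeg a {{ℚ.nonNegative (ℚP.≤-trans (ℚP.nonNegative⁻¹ 1ℚ) 1≤a)}} (1≤^ℚ s 1≤a))

≤∞-refl : ∀ {u} → u ≤∞ u
≤∞-refl {just a}  = ℚP.≤-refl
≤∞-refl {nothing} = tt

≤∞-∞ : ∀ u → u ≤∞ nothing
≤∞-∞ (just _) = tt
≤∞-∞ nothing  = tt

≤∞-trans : ∀ {u v w} → u ≤∞ v → v ≤∞ w → u ≤∞ w
≤∞-trans {just a}  {just b}  {just c} a≤b b≤c = ℚP.≤-trans a≤b b≤c
≤∞-trans {u}       {v}       {nothing} _  _   = ≤∞-∞ u
≤∞-trans {just a}  {nothing} {just c} _  ()
≤∞-trans {nothing} {nothing} {just c} _  ()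

+∞-mono : ∀ {u v w x} → u ≤∞ v → w ≤∞ x → (u +∞ w) ≤∞ (v +∞ x)
+∞-mono {just a}  {just b} {just c}  {just d}  a≤b c≤d = ℚP.+-mono-≤ a≤b c≤d
+∞-mono {u}       {nothing} {w}      {x}       _   _   = ≤∞-∞ (u +∞ w)
+∞-mono {u}       {just b} {w}       {nothing} _   _   = ≤∞-∞ (u +∞ w)
+∞-mono {just a}  {just b} {nothing} {just d}  _   ()
+∞-mono {nothing} {just b} {w}       {just d}  ()  _

+∞-assoc : ∀ u v w → (u +∞ v) +∞ w ≡ u +∞ (v +∞ w)
+∞-assoc (just a) (just b) (just c) = cong just (ℚP.+-assoc a b c)
+∞-assoc (just a) (just b) nothing  = refl
+∞-assoc (just a) nothing  w        = refl
+∞-assoc nothing  v        w        = refl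

+∞-comm : ∀ u v → u +∞ v ≡ v +∞ u
+∞-comm (just a) (just b) = cong just (ℚP.+-comm a b)
+∞-comm (just a) nothing  = refl
+∞-comm nothing  (just b) = refl
+∞-comm nothing  nothing  = refl

+∞-identityˡ : ∀ u → just 0ℚ +∞ u ≡ u
+∞-identityˡ (just a) = cong just (ℚP.+-identityˡ a)
+∞-identityˡ nothing  = refl

module ℚ∞Sum = OrderedSum _+∞_ (just 0ℚ) _≤∞_ ≤∞-refl +∞-mono +∞-assoc +∞-comm +∞-identityˡ

sum≥*length : ∀ {A : Set} {g : A → ℚ∞} {a} xs → All (λ x → just a ≤∞ g x) xs →
              just (a ℚ.* fromℕ (length xs)) ≤∞ ℚ∞Sum.sum g xs
sum≥*length {a = a} []       []           = ℚP.≤-reflexive (ℚP.*-zeroʳ a)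
sum≥*length {g = g} {a} (x ∷ xs) (a≤gx ∷ a≤g) =
  subst (_≤∞ ℚ∞Sum.sum g (x ∷ xs)) (cong just (sym (*-fromℕ-suc a (length xs)))) (+∞-mono a≤gx (sum≥*length xs a≤g))

^∞-nonneg : ∀ {u} s → just 0ℚ ≤∞ u → just 0ℚ ≤∞ (u ^∞ s)
^∞-nonneg {just a}  s 0≤a = ^ℚ-nonneg s 0≤a
^∞-nonneg {nothing} s _   = tt

≤^∞ : ∀ {a u} s → 1 ≤ s → 1ℚ ℚ.≤ a → just a ≤∞ u → just a ≤∞ (u ^∞ s)
≤^∞ {u = just b}  s 1≤s 1≤a a≤b = ℚP.≤-trans a≤b (≤^ℚ s 1≤s (ℚP.≤-trans 1≤a a≤b))
≤^∞ {u = nothing} s _   _   _   = tt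

ωval-nonneg : ∀ θ c → just 0ℚ ≤∞ ωval θ c
ωval-nonneg θ zero with θ ≤ᵇ 0
... | true  = ℚP.≤-refl
... | false = tt
ωval-nonneg θ (suc c) with θ ≤ᵇ suc c
... | true  = ℚP.≤-refl
... | false = ℚP.nonNegative⁻¹ _ {{ℚP.normalize-nonNeg θ (suc c)}}

-- A nonzero weight is θ/c ≥ 1, and then m·θ/c ≤ θ/2 says c ≥ 2m.
ωval-room : ∀ θ c m {a} → 2 * m ≤ θ → ωval θ c ≡ just a → (1ℚ ℚ.≤ a → a ℚ.* fromℕ m ℚ.≤ + θ / 2) → 2 * m ≤ c
ωval-room θ zero m 2m≤θ ω≡a bound with θ ≤ᵇ 0 in θ≤0
... | true = ℕP.≤-trans 2m≤θ (≤ᵇ-true⁻ θ≤0)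
ωval-room θ zero m 2m≤θ () bound | false
ωval-room θ (suc c) m 2m≤θ ω≡a bound with θ ≤ᵇ suc c in θ≤c
... | true  = ℕP.≤-trans 2m≤θ (≤ᵇ-true⁻ θ≤c)
ωval-room θ (suc c) m 2m≤θ refl bound | false =
  θ/c*m≤θ/2⇒2m≤c θ c m {{ℕ.>-nonZero (ℕP.<-trans (s≤s z≤n) c<θ)}} (bound (1≤θ/c θ c (ℕP.<⇒≤ c<θ)))
  where
  c<θ : suc c < θ
  c<θ = ≤ᵇ-false⁻ θ≤c

inPart-unique : ∀ {n k} (vp : Fin n → Maybe (Fin k)) v {i j} → inPart vp v i ≡ true → inPart vp v j ≡ true → i ≡ j
inPart-unique vp v v∈Vᵢ v∈Vⱼ with vp v
... | just l = trans (sym (true-≡ v∈Vᵢ)) (true-≡ v∈Vⱼ)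

module _ {d k : ℕ} (S : Setting d k) (φ : V'H S) where
  open Setting S

  Placed : Fin k → List (Fin h) → Fin h → Set
  Placed i prev y = ∃ λ v → Nb S φ y i v ≡ true × usedB S φ prev v ≡ false × φ (inj₁ y) ≡ inj₁ v

  count-used≤length : ∀ prev → count (usedB S φ prev) ≤ length prev
  count-used≤length = count-any≤length (λ x v → ⌊ ≡-dec _≟_ _≟_ (φ (inj₁ x)) (inj₁ v) ⌋)
    (λ x u v x↦u x↦v → inj₁-injective (trans (sym (true-≡ x↦u)) (true-≡ x↦v)))

  rule-3-3 : ∀ {i prev y} → StepOK S φ i prev y → 2 * suc (length prev) ≤ count (Nb S φ y i) → Placed i prev y
  rule-3-3 {i} {prev} {y} step room = placed-free (if-else at-most-half-used (if-else nonempty step))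
    where
    candidate = Nb S φ y i
    used = usedB S φ prev
    free : Fin n → Bool
    free v = candidate v ∧ not (used v)
    placed-free : (∃ λ v → free v ≡ true × φ (inj₁ y) ≡ inj₁ v) → Placed i prev y
    placed-free (v , free-v , y↦v) = v , proj₁ (∧-not-true⁻ free-v) , proj₂ (∧-not-true⁻ free-v) , y↦v
    nonempty : (count candidate ≡ᵇ 0) ≡ false
    nonempty = ≢0⇒≡ᵇ0-false (ℕP.<-≤-trans (s≤s z≤n) room)
    candidate≤free+used : count candidate ≤ count free + length prev
    candidate≤free+used = ℕP.≤-trans (count-≤-+ candidate free used (λ v → ∧-not-split))
                                     (ℕP.+-monoʳ-≤ (count free) (count-used≤length prev))
    at-most-half-used : (2 * count free <ᵇ count candidate) ≡ false
    at-most-half-used = ≤⇒<ᵇ-false (half-free (count candidate) (count free) (length prev) candidate≤free+used room)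

  Placed-avoids : ∀ {i pre x y} → Placed i (reverse pre) y → x ∈ pre → φ (inj₁ x) ≢ φ (inj₁ y)
  Placed-avoids (v , _ , unused , y↦v) x∈pre x≡y =
    subst T unused (Any.any⁺ _ (Any.reverse⁺ (Any.map (λ { refl → fromWitness (trans x≡y y↦v) }) x∈pre)))

  ValidSeq-split : ∀ {i prev} pre {y post} → ValidSeq S φ i prev (pre ++ y ∷ post) → StepOK S φ i (reverseAcc prev pre) y
  ValidSeq-split []        (step , _) = step
  ValidSeq-split (x ∷ pre) (_ , rest) = ValidSeq-split pre rest

  Ordering : Fin k → Set
  Ordering i = Σ (List (Fin h)) λ ord →
    Unique ord ×
    (∀ x → (x ∈ ord) ⇔ (wp x ≡ i)) ×
    Linked (λ x y → ω S φ y ≤∞ ω S φ x) ord ×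
    ValidSeq S φ i [] ord

  module _ (s : ℕ) (1≤s : 1 ≤ s) {i : Fin k}
           (small : 2 * sizeW S i ≤ θ i) (light : sumω S s φ i ≤∞ just (+ θ i / 2)) where

    weight : Fin h → ℚ∞
    weight x = if ⌊ wp x ≟ i ⌋ then ω S φ x ^∞ s else just 0ℚ

    weight-in-part : ∀ {x} → wp x ≡ i → weight x ≡ ω S φ x ^∞ s
    weight-in-part {x} x∈Wᵢ with wp x ≟ i
    ... | yes _   = refl
    ... | no x∉Wᵢ = ⊥-elim (x∉Wᵢ x∈Wᵢ)

    weight-nonneg : ∀ x → just 0ℚ ≤∞ weight x
    weight-nonneg x with ⌊ wp x ≟ i ⌋
    ... | true  = ^∞-nonneg s (ωval-nonneg (θ (wp x)) (count (Nb S φ x (wp x))))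
    ... | false = ℚP.≤-refl

    sum-weight≤θ/2 : ∀ {xs} → Unique xs → ℚ∞Sum.sum weight xs ≤∞ just (+ θ i / 2)
    sum-weight≤θ/2 uniq = ≤∞-trans (ℚ∞Sum.sum-mono-⊆ weight-nonneg uniq (λ {x} _ → ∈-allFin x))
      (subst (_≤∞ just (+ θ i / 2)) (ℚ∞Sum.sum-if (λ x → ⌊ wp x ≟ i ⌋) (λ x → ω S φ x ^∞ s) (allFin h)) light)

    sum-prefix≤θ/2 : ∀ {pre y post} → Unique (pre ++ y ∷ post) → ℚ∞Sum.sum weight (y ∷ pre) ≤∞ just (+ θ i / 2)
    sum-prefix≤θ/2 {pre} {y} {post} uniq = ≤∞-trans (ℚ∞Sum.sum-before weight-nonneg pre y post) (sum-weight≤θ/2 uniq)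

    weight-finite : ∀ {pre y post} → Unique (pre ++ y ∷ post) → wp y ≡ i → ∃ λ a → ω S φ y ≡ just a
    weight-finite {pre} {y} uniq y∈Wᵢ with ω S φ y in ω≡
    ... | just a  = a , refl
    ... | nothing = ⊥-elim (subst (λ w → (w +∞ ℚ∞Sum.sum weight pre) ≤∞ just (+ θ i / 2))
                                  (trans (weight-in-part y∈Wᵢ) (cong (_^∞ s) ω≡)) (sum-prefix≤θ/2 uniq))

    prefix-weight : ∀ {pre y post a} → Unique (pre ++ y ∷ post) → All (λ z → wp z ≡ i) (y ∷ pre) →
                    All (λ z → just a ≤∞ ω S φ z) (y ∷ pre) → 1ℚ ℚ.≤ a → a ℚ.* fromℕ (suc (length pre)) ℚ.≤ + θ i / 2
    prefix-weight {pre} {y} {a = a} uniq in-part heavy 1≤a =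
      ≤∞-trans (sum≥*length (y ∷ pre) (All.zipWith heavier (in-part , heavy))) (sum-prefix≤θ/2 uniq)
      where
      heavier : ∀ {z} → wp z ≡ i × just a ≤∞ ω S φ z → just a ≤∞ weight z
      heavier (z∈Wᵢ , a≤ωz) = subst (just a ≤∞_) (sym (weight-in-part z∈Wᵢ)) (≤^∞ s 1≤s 1≤a a≤ωz)

    2·position≤θ : ∀ {pre y post} → Unique (pre ++ y ∷ post) → (∀ {x} → x ∈ pre ++ y ∷ post → wp x ≡ i) →
                   2 * suc (length pre) ≤ θ i
    2·position≤θ {pre} {y} {post} uniq in-part =
      ℕP.≤-trans (ℕP.*-monoʳ-≤ 2 (ℕP.≤-trans position≤length (length≤count uniq (All.tabulate (≡-true ∘ in-part))))) small
      where
      position≤length : suc (length pre) ≤ length (pre ++ y ∷ post)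
      position≤length = ℕP.≤-trans (s≤s (length-++-≤ˡ pre)) (ℕP.≤-reflexive (sym (length-++-sucʳ pre y post)))

    placed : (o : Ordering i) → ∀ {pre y post} → proj₁ o ≡ pre ++ y ∷ post → Placed i (reverse pre) y
    placed (_ , uniq , members , sorted , valid) {pre} {y} {post} refl =
      rule-3-3 {i} {reverse pre} {y} (ValidSeq-split pre valid)
        (subst (λ p → 2 * suc p ≤ count (Nb S φ y i)) (sym (length-reverse pre)) (room (weight-finite uniq y∈Wᵢ)))
      where
      in-part : ∀ {x} → x ∈ pre ++ y ∷ post → wp x ≡ i
      in-part {x} = Equivalence.to (members x)
      y∈Wᵢ : wp y ≡ i
      y∈Wᵢ = in-part (∈-++⁺ʳ pre (here refl))
      earlier-heavier : All (λ z → ω S φ y ≤∞ ω S φ z) pre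
      earlier-heavier = AllPairs-before pre (Linked⇒AllPairs (λ xy yz → ≤∞-trans yz xy) sorted)
      room : (∃ λ a → ω S φ y ≡ just a) → 2 * suc (length pre) ≤ count (Nb S φ y i)
      room (a , ω≡a) = ωval-room (θ i) _ (suc (length pre)) (2·position≤θ uniq in-part)
        (trans (cong (λ j → ωval (θ j) (count (Nb S φ y j))) (sym y∈Wᵢ)) ω≡a)
        (prefix-weight uniq (y∈Wᵢ ∷ All.tabulate (in-part ∘ ∈-++⁺ˡ))
                            (subst (just a ≤∞_) (sym ω≡a) ℚP.≤-refl ∷ All.map (λ {z} → subst (_≤∞ ω S φ z) ω≡a) earlier-heavier))

  embedding : (ord : Fin k → List (Fin h)) → (∀ x → x ∈ ord (wp x)) →
              (∀ {i pre y post} → ord i ≡ pre ++ y ∷ post → Placed i (reverse pre) y) → IsEmbedding S φ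
  embedding ord complete placed = f , f-image , f-injective , f-adjacent
    where
    image : ∀ x → ∃ λ v → Nb S φ x (wp x) v ≡ true × φ (inj₁ x) ≡ inj₁ v
    image x with ∈-∃++ (complete x)
    ... | pre , _ , split with placed split
    ...   | v , candidate , _ , x↦v = v , candidate , x↦v

    f : Fin h → Fin n
    f x = proj₁ (image x)

    f-image : ∀ x → φ (inj₁ x) ≡ inj₁ (f x)
    f-image x = proj₂ (proj₂ (image x))

    f-candidate : ∀ x → inV S (f x) (wp x) ≡ true × allB (λ j → adjG' S (φ (e x j)) (inj₁ (f x))) ≡ true
    f-candidate x = ∧-true⁻ (proj₁ (proj₂ (image x)))

    same-part : ∀ {x y} → f x ≡ f y → wp x ≡ wp y
    same-part {x} {y} fx≡fy =
      inPart-unique vp (f y) (subst (λ v → inV S v (wp x) ≡ true) fx≡fy (proj₁ (f-candidate x))) (proj₁ (f-candidate y))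

    same-image : ∀ {x y} → f x ≡ f y → φ (inj₁ x) ≡ φ (inj₁ y)
    same-image {x} {y} fx≡fy = trans (f-image x) (trans (cong inj₁ fx≡fy) (sym (f-image y)))

    f-injective : ∀ {x y} → f x ≡ f y → x ≡ y
    f-injective {x} {y} fx≡fy with x ≟ y
    ... | yes x≡y = x≡y
    ... | no x≢y with ∈-order (subst (λ j → x ∈ ord j) (same-part fx≡fy) (complete x)) (complete y) x≢y
    ...   | inj₁ (_ , _ , split , x∈pre) = ⊥-elim (Placed-avoids (placed split) x∈pre (same-image fx≡fy))
    ...   | inj₂ (_ , _ , split , y∈pre) = ⊥-elim (Placed-avoids (placed split) y∈pre (sym (same-image fx≡fy)))

    forward-adjacent : ∀ x y → adjH x y ≡ true → wp x Fin.< wp y → adjG (f y) (f x) ≡ true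
    forward-adjacent x y xy lt = subst (λ u → adjG' S u (inj₁ (f x)) ≡ true) (trans (cong φ x→y) (f-image y))
                                       (allB-true⁻ (proj₂ (f-candidate x)) j)
      where
      not-last : ¬ isLast (wp x)
      not-last last = ℕP.<-irrefl refl (ℕP.<-≤-trans (FinP.toℕ<n (wp y)) (subst (_≤ toℕ (wp y)) last lt))
      j = proj₁ (Equivalence.to (proj₂ (e-fwd x not-last) y) (xy , lt))
      x→y : e x j ≡ inj₁ y
      x→y = proj₂ (Equivalence.to (proj₂ (e-fwd x not-last) y) (xy , lt))

    f-adjacent : ∀ x y → adjH x y ≡ true → adjG (f x) (f y) ≡ true
    f-adjacent x y xy with FinP.<-cmp (wp x) (wp y)
    ... | tri< lt _ _ = trans (symG (f x) (f y)) (forward-adjacent x y xy lt)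
    ... | tri≈ _ eq _ = ⊥-elim (indep x y xy eq)
    ... | tri> _ _ gt = forward-adjacent y x (trans (symH y x) xy) gt

lemma4p3 : (d k : ℕ) (S : Setting d k) →
    (∀ i → 2 * sizeW S i ≤ Setting.θ S i) →
    (s : ℕ) → 1 ≤ s →
    (φ : V'H S) →
    Possible S φ →
    (∀ i → sumω S s φ i ≤∞ just ((+ Setting.θ S i) / 2)) →
    IsEmbedding S φ
lemma4p3 d k S small s 1≤s φ (_ , orderings) light =
  embedding S φ (proj₁ ∘ orderings) (λ x → Equivalence.from (proj₁ (proj₂ (proj₂ (orderings (Setting.wp S x)))) x) refl)
            (λ {i} → placed S φ s 1≤s (small i) (light i) (orderings i))
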